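{- Let $k\geq 3$ and let $F$ be a separating set of $A_{n,k}$ with $|F|\leq (3k-2)(n-k)-3$. Let $I,J,F_I$ be as in the context. If $H$ is a union of components of $A_{n,k}-F$ none of which contains a vertex of $A^J_{n,k}-F$, then $N^{I}(H)\subseteq F_I$ and $N^{\overline{I}}(H)\subseteq F\setminus F_I$.
   Context: For integers $n>k\geq 1$, the $(n,k)$-arrangement graph $A_{n,k}$ has as vertices all arrangements $p_1\cdots p_k$ of $k$ distinct elements of $\{1,\dots,n\}$, two vertices being adjacent iff they differ in exactly one position. A separating set $F$ is a vertex set with $A_{n,k}-F$ disconnected. For $i\in\{1,\dots,n\}$, $A_{n,k}^i$ is the subgraph induced by vertices with last coordinate $i$. Given $F$: $F_i=F\cap V(A^i_{n,k})$, $f_i=|F_i|$, $I=\{i: f_i\geq (k-1)(n-k)\}$, $J=\{1,\dots,n\}\setminus I$, $F_I=\bigcup_{i\in I}F_i$, $A^J_{n,k}$ the subgraph induced by $\bigcup_{j\in J}V(A^j_{n,k})$. For a vertex set/subgraph $H$, $N(H)$ is the set of vertices not in $H$ adjacent to some vertex of $H$; $N^I(H)$ is the set of vertices of $N(H)$ lying in $\bigcup_{i\in I}V(A^i_{n,k})$, and $N^{\overline I}(H)$ is the set of vertices of $N(H)$ lying in $\bigcup_{j\notin I}V(A^j_{n,k})$. -}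

module Defs where

open import Data.Nat using (ℕ; zero; suc; _+_; _*_; _∸_; _≤_; _<_)
open import Data.Fin using (Fin)
open import Data.Fin.Properties renaming (_≟_ to _≟F_)
open import Data.Vec using (Vec; []; _∷_; lookup)
open import Data.List using (List; length; filter)
open import Data.List.Membership.Propositional using (_∈_; _∉_)
open import Data.Maybe using (Maybe; just; nothing)
open import Data.Maybe.Properties using (≡-dec)
open import Data.Product using (Σ; ∃; ∃-syntax; _×_; _,_)
open import Relation.Nullary using (¬_)
open import Relation.Binary.PropositionalEquality using (_≡_; _≢_)

-- Vertices of A_{n,k}: vectors p_1 ... p_k over {1..n} (modelled as Fin n)
-- with pairwise distinct entries.
Word : ℕ → ℕ → Set
Word n k = Vec (Fin n) k

IsArr : ∀ {n k} → Word n k → Set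
IsArr {n} {k} v = ∀ (p q : Fin k) → lookup v p ≡ lookup v q → p ≡ q

Adj : ∀ {n k} → Word n k → Word n k → Set
Adj {n} {k} u v =
  ∃[ p ] (lookup u p ≢ lookup v p × (∀ q → q ≢ p → lookup u q ≡ lookup v q))

lastM : ∀ {A : Set} {k} → Vec A k → Maybe A
lastM [] = nothing
lastM (x ∷ []) = just x
lastM (x ∷ y ∷ v) = lastM (y ∷ v)

-- f_i = |F ∩ V(A^i_{n,k})|, F given as a duplicate-free list of vertices
f : ∀ {n k} → List (Word n k) → Fin n → ℕ
f F i = length (filter (λ v → ≡-dec _≟F_ (lastM v) (just i)) F)

InI : ∀ {n k} → List (Word n k) → Fin n → Set
InI {n} {k} F i = (k ∸ 1) * (n ∸ k) ≤ f F i

InJ : ∀ {n k} → List (Word n k) → Fin n → Set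
InJ F i = ¬ InI F i

InFI : ∀ {n k} → List (Word n k) → Word n k → Set
InFI F v = v ∈ F × ∃[ i ] (lastM v ≡ just i × InI F i)

VertexMinus : ∀ {n k} → List (Word n k) → Word n k → Set
VertexMinus F v = IsArr v × v ∉ F

-- u and v joined by a path in A_{n,k} - F (u is assumed to be a vertex of A - F)
data Reach {n k} (F : List (Word n k)) (u : Word n k) : Word n k → Set where
  here : Reach F u u
  step : ∀ {v w} → Reach F u v → Adj v w → VertexMinus F w → Reach F u w

Separating : ∀ {n k} → List (Word n k) → Set
Separating F = ∃[ u ] ∃[ v ] (VertexMinus F u × VertexMinus F v × ¬ Reach F u v)

UnionOfComponents : ∀ {n k} → List (Word n k) → (Word n k → Set) → Set
UnionOfComponents F H =
  (∀ v → H v → VertexMinus F v) × (∀ u v → H u → Reach F u v → H v)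

InN : ∀ {n k} → (Word n k → Set) → Word n k → Set
InN H v = IsArr v × ¬ H v × ∃[ u ] (H u × Adj u v)

InNI : ∀ {n k} → List (Word n k) → (Word n k → Set) → Word n k → Set
InNI F H v = InN H v × ∃[ i ] (lastM v ≡ just i × InI F i)

InNIbar : ∀ {n k} → List (Word n k) → (Word n k → Set) → Word n k → Set
InNIbar F H v = InN H v × ∃[ i ] (lastM v ≡ just i × ¬ InI F i)

module Submission where

open import Defs
open import Data.Nat using (ℕ; _*_; _∸_; _≤_; _<_)
open import Data.Fin using (Fin)
open import Data.Fin.Properties using () renaming (_≟_ to _≟F_)
open import Data.Vec.Properties using () renaming (≡-dec to ≡-decVec)
open import Data.List using (List; length)
open import Data.List.Relation.Unary.All using (All)
open import Data.List.Relation.Unary.Unique.Propositional using (Unique)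
open import Data.List.Membership.Propositional using (_∈_)
import Data.List.Membership.DecPropositional as DecMembership
open import Data.Maybe using (just)
open import Data.Maybe.Properties using (just-injective)
open import Data.Product using (_×_; _,_; proj₂)
open import Relation.Nullary using (¬_; yes; no; contradiction)
open import Relation.Binary.PropositionalEquality using (_≡_; trans; sym; subst)

-- A neighbour of H outside F would extend a path of A_{n,k} - F out of H,
-- contradicting that H is closed under reachability. Hence N(H) ⊆ F, and
-- both inclusions only sort N(H) by the last coordinate; none of the
-- hypotheses on k, |F| or J are needed.

module _ {n k : ℕ} {F : List (Word n k)} {H : Word n k → Set}
         (components : UnionOfComponents F H) where

  open DecMembership (≡-decVec {A = Fin n} {n = k} _≟F_) using (_∈?_)

  neighbour∈separator : ∀ v → InN H v → v ∈ F
  neighbour∈separator v (arr , v∉H , u , u∈H , u~v) with v ∈? F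
  ... | yes v∈F = v∈F
  ... | no  v∉F = contradiction (proj₂ components u v u∈H (step here u~v (arr , v∉F))) v∉H

  neighbourI⊆F_I : ∀ v → InNI F H v → InFI F v
  neighbourI⊆F_I v (v∈N , i , last≡i , i∈I) = neighbour∈separator v v∈N , i , last≡i , i∈I

  neighbourĪ⊆F∖F_I : ∀ v → InNIbar F H v → v ∈ F × ¬ InFI F v
  neighbourĪ⊆F∖F_I v (v∈N , i , last≡i , i∉I) =
    neighbour∈separator v v∈N ,
    λ (_ , j , last≡j , j∈I) → i∉I (subst (InI F) (just-injective (trans (sym last≡j) last≡i)) j∈I)

corollary3p6 : (n k : ℕ) → 3 ≤ k → k < n →
    (F : List (Word n k)) → Unique F → All IsArr F →
    Separating F →
    length F ≤ (3 * k ∸ 2) * (n ∸ k) ∸ 3 →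
    (H : Word n k → Set) → UnionOfComponents F H →
    (∀ v i → H v → lastM v ≡ just i → ¬ InJ F i) →
    (∀ v → InNI F H v → InFI F v) ×
    (∀ v → InNIbar F H v → (v ∈ F × ¬ InFI F v))
corollary3p6 _ _ _ _ _ _ _ _ _ _ components _ =
  neighbourI⊆F_I components , neighbourĪ⊆F∖F_I components
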